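{- Let $p\ge1$ and $\mathbf{a}=(a_1,\dots,a_p)\in\mathbb{Z}_{\ge0}^p$. The number of cyclic integer flows on $H_{1,p}$ whose netflow at the source $(0,i)$ is $a_i$ for each $i$ equals $\binom{a_1+\dots+a_p+2p-2}{p-1}$.
   Context: $H_{1,p}$ is the directed graph with vertices $(0,i),(1,i),(2,i)$ for $i\in\{1,\dots,p\}$ and edges $(0,i)\to(1,i)$, $(1,i)\to(2,i)$ and $(1,i)\to(1,i+1\bmod p)$; the vertices $(0,i)$ are the sources, $(2,i)$ the sinks, and the edges $(1,i)\to(1,i+1)$ form its unique minimal directed cycle. Netflow of $f$ at $v$ is outflow minus inflow. A cyclic integer flow on $H_{1,p}$ is $f:E\to\mathbb{Z}_{\ge0}$ such that exactly one edge $e_C$ of the cycle has $f(e_C)=0$, and the netflow is $1$ at every vertex $(1,i)$ except at the tail of $e_C$, where it is $0$. -}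

module Defs where

open import Level using (0ℓ)
open import Data.Nat using (ℕ; zero; suc)
open import Data.Nat.DivMod using (_%_; m%n<n)
open import Data.Fin using (Fin; toℕ; fromℕ<) renaming (_≟_ to _≟F_)
open import Data.Integer using (ℤ; +_; _-_)
open import Data.List using (List; map; _++_; filter; allFin)
open import Data.Nat.ListAction using (sum)
open import Data.Vec using (Vec; lookup)
open import Data.Product using (Σ; _×_)
open import Relation.Nullary using (¬_; Dec; yes; no)
open import Relation.Binary using (Setoid)
open import Relation.Binary.PropositionalEquality
  using (_≡_; refl; sym; trans; cong)

-- Vertices of H_{1,p}: (0,i) = src i, (1,i) = mid i, (2,i) = snk i,
-- with i ranging over Fin p (i.e. {0,…,p-1} instead of {1,…,p}).
data Vertex (p : ℕ) : Set where
  src mid snk : Fin p → Vertex p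

data Edge (p : ℕ) : Set where
  inE outE cycE : Fin p → Edge p

sucMod : {p : ℕ} → Fin p → Fin p
sucMod {suc n} i = fromℕ< (m%n<n (suc (toℕ i)) (suc n))

tail : {p : ℕ} → Edge p → Vertex p
tail (inE i) = src i
tail (outE i) = mid i
tail (cycE i) = mid i

head : {p : ℕ} → Edge p → Vertex p
head (inE i) = mid i
head (outE i) = snk i
head (cycE i) = mid (sucMod i)

_≟V_ : {p : ℕ} → (u v : Vertex p) → Dec (u ≡ v)
src i ≟V src j with i ≟F j
... | yes refl = yes refl
... | no ne = no λ { refl → ne refl }
mid i ≟V mid j with i ≟F j
... | yes refl = yes refl
... | no ne = no λ { refl → ne refl }
snk i ≟V snk j with i ≟F j
... | yes refl = yes refl
... | no ne = no λ { refl → ne refl }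
src _ ≟V mid _ = no λ ()
src _ ≟V snk _ = no λ ()
mid _ ≟V src _ = no λ ()
mid _ ≟V snk _ = no λ ()
snk _ ≟V src _ = no λ ()
snk _ ≟V mid _ = no λ ()

allEdges : (p : ℕ) → List (Edge p)
allEdges p = map inE (allFin p) ++ map outE (allFin p) ++ map cycE (allFin p)

outflow inflow : {p : ℕ} → (Edge p → ℕ) → Vertex p → ℕ
outflow {p} f v = sum (map f (filter (λ e → tail e ≟V v) (allEdges p)))
inflow  {p} f v = sum (map f (filter (λ e → head e ≟V v) (allEdges p)))

netflow : {p : ℕ} → (Edge p → ℕ) → Vertex p → ℤ
netflow f v = + outflow f v - + inflow f v

IsCyclicFlow : {p : ℕ} → (Edge p → ℕ) → Set
IsCyclicFlow {p} f =
  Σ (Fin p) λ j →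
    (f (cycE j) ≡ 0)
  × (∀ k → f (cycE k) ≡ 0 → k ≡ j)
  × (netflow f (mid j) ≡ + 0)
  × (∀ i → ¬ (i ≡ j) → netflow f (mid i) ≡ + 1)

record CyclicFlow (p : ℕ) (a : Vec ℕ p) : Set where
  field
    flow     : Edge p → ℕ
    cyclic   : IsCyclicFlow flow
    srcFlow  : ∀ i → netflow flow (src i) ≡ + lookup a i

open CyclicFlow public

_≈F_ : {p : ℕ} {a : Vec ℕ p} → CyclicFlow p a → CyclicFlow p a → Set
F ≈F G = ∀ e → flow F e ≡ flow G e

CyclicFlowSetoid : (p : ℕ) → Vec ℕ p → Setoid 0ℓ 0ℓ
CyclicFlowSetoid p a = record
  { Carrier = CyclicFlow p a
  ; _≈_ = _≈F_
  ; isEquivalence = record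
    { refl = λ e → refl
    ; sym = λ x e → sym (x e)
    ; trans = λ x y e → trans (x e) (y e)
    }
  }

{-# OPTIONS --safe #-}
-- Write yᵢ for the flow on (1,i)→(2,i) and cᵢ for the flow on (1,i)→(1,i+1).  The sources
-- force the flow aᵢ on (0,i)→(1,i), and if the empty cycle edge leaves (1,j), conservation at
-- (1,i) says cᵢ − cᵢ₋₁ = bᵢ − [i = j] with bᵢ = 1 + aᵢ − yᵢ.  Going once around the cycle
-- gives Σ b = 1, i.e. Σ y = Σ a + p − 1.  Conversely, with Q the prefix sums of b, the
-- solution vanishing at j is cᵢ = Qᵢ − Qⱼ + [i < j] (a cycle lemma), which is positive away
-- from j exactly when j is the last index where Q is minimal.  So cyclic flows correspond to
-- the weak compositions y of Σ a + p − 1 into p parts, counted by stars and bars.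
module Submission where

open import Defs
open import Data.Nat using (ℕ; zero; suc)
open import Data.Fin using (Fin)
open import Data.Vec using (Vec; sum)

module Compositions where

  open import Data.Nat using (_+_)
  open import Data.Nat.Properties using (≡-irrelevant; +-identityʳ; +-suc; suc-injective)
  open import Data.Nat.Combinatorics using (_C_; nCn≡1; nCk+nC[k+1]≡[n+1]C[k+1])
  open import Data.Fin using (zero)
  open import Data.Fin.Properties using (+↔⊎)
  open import Data.Vec using ([]; _∷_; replicate)
  open import Data.Product using (Σ; _,_; proj₁)
  open import Data.Sum using (_⊎_; inj₁; inj₂)
  open import Data.Sum.Function.Propositional using (_⊎-↔_)
  open import Function.Bundles using (_↔_; mk↔ₛ′)
  open import Function.Related.Propositional using (module EquationalReasoning; bijection)
  open import Relation.Binary.PropositionalEquality using (_≡_; refl; sym; trans; cong)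
  open EquationalReasoning {bijection}

  Composition : ℕ → ℕ → Set
  Composition n k = Σ (Vec ℕ k) λ parts → sum parts ≡ n

  Composition-≡ : ∀ {n k} {c d : Composition n k} → proj₁ c ≡ proj₁ d → c ≡ d
  Composition-≡ {c = parts , e} {d = .parts , e′} refl = cong (parts ,_) (≡-irrelevant e e′)

  Fin1↔ : {A : Set} (x : A) → (∀ y → y ≡ x) → Fin 1 ↔ A
  Fin1↔ x unique = mk↔ₛ′ (λ _ → x) (λ _ → zero) (λ y → sym (unique y)) λ { zero → refl }

  sum-replicate-zero : ∀ k → sum (replicate k 0) ≡ 0
  sum-replicate-zero zero    = refl
  sum-replicate-zero (suc k) = sum-replicate-zero k

  sum≡0⇒replicate-zero : ∀ {k} (parts : Vec ℕ k) → sum parts ≡ 0 → parts ≡ replicate k 0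
  sum≡0⇒replicate-zero []             _ = refl
  sum≡0⇒replicate-zero (zero ∷ parts) e = cong (0 ∷_) (sum≡0⇒replicate-zero parts e)

  Composition-split : ∀ m q →
    (Composition (suc m) (suc q) ⊎ Composition m (suc (suc q)))
      ↔ Composition (suc m) (suc (suc q))
  Composition-split m q = mk↔ₛ′ join split join-split split-join
    where
    join : Composition (suc m) (suc q) ⊎ Composition m (suc (suc q))
         → Composition (suc m) (suc (suc q))
    join (inj₁ (parts , e))     = 0 ∷ parts , e
    join (inj₂ (x ∷ parts , e)) = suc x ∷ parts , cong suc e
    split : Composition (suc m) (suc (suc q))
          → Composition (suc m) (suc q) ⊎ Composition m (suc (suc q))
    split (zero ∷ parts , e)  = inj₁ (parts , e)
    split (suc x ∷ parts , e) = inj₂ (x ∷ parts , suc-injective e)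
    join-split : ∀ c → join (split c) ≡ c
    join-split (zero ∷ parts , e)  = refl
    join-split (suc x ∷ parts , e) = Composition-≡ refl
    split-join : ∀ c → split (join c) ≡ c
    split-join (inj₁ c)               = refl
    split-join (inj₂ (x ∷ parts , e)) = cong inj₂ (Composition-≡ refl)

  stars-and-bars : ∀ q n → Fin ((n + q) C q) ↔ Composition n (suc q)
  stars-and-bars zero n = Fin1↔ (n ∷ [] , +-identityʳ n)
    λ { (x ∷ [] , e) → Composition-≡ (cong (_∷ []) (trans (sym (+-identityʳ x)) e)) }
  stars-and-bars (suc q) zero = begin
    Fin (suc q C suc q)          ≡⟨ cong Fin (nCn≡1 (suc q)) ⟩
    Fin 1                        ↔⟨ Fin1↔ (replicate _ 0 , sum-replicate-zero (suc (suc q)))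
                                      (λ (parts , e) → Composition-≡ (sum≡0⇒replicate-zero parts e)) ⟩
    Composition 0 (suc (suc q))  ∎
  stars-and-bars (suc q) (suc m) = begin
    Fin ((suc m + suc q) C suc q)                          ≡⟨ cong Fin pascal ⟩
    Fin ((suc m + q) C q + (m + suc q) C suc q)            ↔⟨ +↔⊎ ⟩
    (Fin ((suc m + q) C q) ⊎ Fin ((m + suc q) C suc q))
      ↔⟨ stars-and-bars q (suc m) ⊎-↔ stars-and-bars (suc q) m ⟩
    (Composition (suc m) (suc q) ⊎ Composition m (suc (suc q)))
      ↔⟨ Composition-split m q ⟩
    Composition (suc m) (suc (suc q))                      ∎
    where
    pascal : (suc m + suc q) C suc q ≡ (suc m + q) C q + (m + suc q) C suc q
    pascal = trans (sym (nCk+nC[k+1]≡[n+1]C[k+1] (m + suc q) q))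
                   (cong (λ n → n C q + (m + suc q) C suc q) (+-suc m q))

module CyclicSuccessor where

  open import Data.Nat using (s≤s; _%_)
  open import Data.Nat.DivMod using (n%n≡0; m<n⇒m%n≡m)
  open import Data.Fin using (zero; suc; toℕ; fromℕ; inject₁)
  open import Data.Fin.Properties
    using (toℕ-injective; toℕ-fromℕ<; toℕ-fromℕ; toℕ-inject₁; toℕ<n)
  open import Data.Fin.Relation.Unary.Top using (view; ‵fromℕ; ‵inject₁)
  open import Relation.Binary.PropositionalEquality
    using (_≡_; sym; trans; cong; module ≡-Reasoning)
  open ≡-Reasoning

  sucMod-fromℕ : ∀ q → sucMod (fromℕ q) ≡ zero
  sucMod-fromℕ q = toℕ-injective (begin
    toℕ (sucMod (fromℕ q))       ≡⟨ toℕ-fromℕ< _ ⟩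
    suc (toℕ (fromℕ q)) % suc q  ≡⟨ cong (λ n → suc n % suc q) (toℕ-fromℕ q) ⟩
    suc q % suc q                ≡⟨ n%n≡0 (suc q) ⟩
    0                            ∎)

  sucMod-inject₁ : ∀ {q} (i : Fin q) → sucMod (inject₁ i) ≡ suc i
  sucMod-inject₁ {q} i = toℕ-injective (begin
    toℕ (sucMod (inject₁ i))       ≡⟨ toℕ-fromℕ< _ ⟩
    suc (toℕ (inject₁ i)) % suc q  ≡⟨ cong (λ n → suc n % suc q) (toℕ-inject₁ i) ⟩
    suc (toℕ i) % suc q            ≡⟨ m<n⇒m%n≡m (s≤s (toℕ<n i)) ⟩
    suc (toℕ i)                    ∎)

  predMod : ∀ {q} → Fin (suc q) → Fin (suc q)
  predMod zero    = fromℕ _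
  predMod (suc i) = inject₁ i

  sucMod-predMod : ∀ {q} (i : Fin (suc q)) → sucMod (predMod i) ≡ i
  sucMod-predMod zero    = sucMod-fromℕ _
  sucMod-predMod (suc i) = sucMod-inject₁ i

  predMod-sucMod : ∀ {q} (k : Fin (suc q)) → predMod (sucMod k) ≡ k
  predMod-sucMod k with view k
  ... | ‵fromℕ     = cong predMod (sucMod-fromℕ _)
  ... | ‵inject₁ i = cong predMod (sucMod-inject₁ i)

  sucMod-injective : ∀ {q} {k m : Fin (suc q)} → sucMod k ≡ sucMod m → k ≡ m
  sucMod-injective {k = k} {m} eq =
    trans (sym (predMod-sucMod k)) (trans (cong predMod eq) (predMod-sucMod m))

module CycleLemma where

  open import Data.Nat using (s≤s; z≤n)
  open import Data.Nat.Properties using (n≢0⇒n>0)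
  open import Data.Integer using (ℤ; +_; 0ℤ; 1ℤ; _+_; _-_; _≤_; _<_; ∣_∣; +<+; pred)
  open import Data.Integer.Properties
    using ( +-assoc; +-comm; +-identityˡ; +-identityʳ; +-inverseʳ; +-injective
          ; _≤?_; ≰⇒>; ≤-reflexive; <⇒≤; <-irrefl; <-trans; <-≤-trans; ≤⇒≯; +-mono-≤-<
          ; pred-suc; i≤j⇒0≤j-i; 0≤i-j⇒j≤i; i<j⇒suc[i]≤j; suc[i]≤j⇒i<j; i<j⇒i≤pred[j]
          ; i-j≡0⇒i≡j; 0≤i⇒+∣i∣≡i)
  open import Data.Integer.Tactic.RingSolver using (solve-∀)
  open import Data.Fin as Fin using (zero; suc; fromℕ; inject₁; _≟_)
  open import Data.Fin.Properties using (<-cmp; <⇒≢)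
  open import Data.Fin.Relation.Unary.Top using (view; ‵fromℕ; ‵inject₁)
  open import Data.Product using (Σ; _×_; _,_; proj₁; proj₂)
  open import Function using (_∘_)
  open import Relation.Binary.Definitions using (tri<; tri≈; tri>)
  open import Relation.Binary.PropositionalEquality
    using (_≡_; _≢_; refl; sym; trans; cong; cong₂; subst; module ≡-Reasoning)
  open import Relation.Nullary using (yes; no; contradiction)
  open import Relation.Nullary.Decidable using (decidable-stable)
  open CyclicSuccessor
  open ≡-Reasoning

  0<+1⇒0≤ : ∀ {z} → 0ℤ < z + 1ℤ → 0ℤ ≤ z
  0<+1⇒0≤ {z} h =
    subst (0ℤ ≤_) (trans (cong pred (+-comm z 1ℤ)) (pred-suc z)) (i<j⇒i≤pred[j] h)

  0≤⇒0<+1 : ∀ {z} → 0ℤ ≤ z → 0ℤ < z + 1ℤ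
  0≤⇒0<+1 h = +-mono-≤-< h (+<+ (s≤s z≤n))

  y-[1+x]+1≡y-x+0 : ∀ x y → y - (1ℤ + x) + 1ℤ ≡ y - x + 0ℤ
  y-[1+x]+1≡y-x+0 = solve-∀

  <⇒0<-+0 : ∀ {x y} → x < y → 0ℤ < y - x + 0ℤ
  <⇒0<-+0 {x} {y} x<y =
    subst (0ℤ <_) (y-[1+x]+1≡y-x+0 x y) (0≤⇒0<+1 (i≤j⇒0≤j-i (i<j⇒suc[i]≤j x<y)))

  0<-+0⇒< : ∀ {x y} → 0ℤ < y - x + 0ℤ → x < y
  0<-+0⇒< {x} {y} h =
    suc[i]≤j⇒i<j (0≤i-j⇒j≤i (0<+1⇒0≤ (subst (0ℤ <_) (sym (y-[1+x]+1≡y-x+0 x y)) h)))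

  prefixSum : ∀ {q} → (Fin (suc q) → ℤ) → Fin (suc q) → ℤ
  prefixSum b zero            = b zero
  prefixSum {suc q} b (suc i) = b zero + prefixSum (b ∘ suc) i

  prefixSum-suc : ∀ {q} (b : Fin (suc q) → ℤ) (i : Fin q) →
    prefixSum b (suc i) ≡ prefixSum b (inject₁ i) + b (suc i)
  prefixSum-suc {suc q} b zero    = refl
  prefixSum-suc {suc q} b (suc i) =
    trans (cong (λ t → b zero + t) (prefixSum-suc (b ∘ suc) i)) (sym (+-assoc (b zero) _ _))

  prefixSum-sub : ∀ {q} (b e : Fin (suc q) → ℤ) i →
    prefixSum (λ k → b k - e k) i ≡ prefixSum b i - prefixSum e i
  prefixSum-sub b e zero            = refl
  prefixSum-sub {suc q} b e (suc i) = begin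
    (b zero - e zero) + prefixSum (λ k → b (suc k) - e (suc k)) i
      ≡⟨ cong (λ t → (b zero - e zero) + t) (prefixSum-sub (b ∘ suc) (e ∘ suc) i) ⟩
    (b zero - e zero) + (prefixSum (b ∘ suc) i - prefixSum (e ∘ suc) i)
      ≡⟨ interchange (b zero) (e zero) _ _ ⟩
    (b zero + prefixSum (b ∘ suc) i) - (e zero + prefixSum (e ∘ suc) i)  ∎
    where
    interchange : ∀ x y z w → (x - y) + (z - w) ≡ (x + z) - (y + w)
    interchange = solve-∀

  telescope : ∀ {q} (c d : Fin (suc q) → ℤ) {K} → c zero ≡ K + d zero →
    (∀ i → c (suc i) ≡ c (inject₁ i) + d (suc i)) → ∀ i → c i ≡ K + prefixSum d i
  telescope c d c₀ step zero = c₀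
  telescope {suc q} c d {K} c₀ step (suc i) = trans
    (telescope (c ∘ suc) (d ∘ suc) {K + d zero}
               (trans (step zero) (cong (λ t → t + d (suc zero)) c₀)) (step ∘ suc) i)
    (+-assoc K (d zero) _)

  δ : ∀ {n} → Fin n → Fin n → ℤ
  δ zero    zero    = 1ℤ
  δ zero    (suc _) = 0ℤ
  δ (suc _) zero    = 0ℤ
  δ (suc j) (suc i) = δ j i

  ⟦_<_⟧ : ∀ {n} → Fin n → Fin n → ℤ
  ⟦ _     < zero  ⟧ = 0ℤ
  ⟦ zero  < suc _ ⟧ = 1ℤ
  ⟦ suc i < suc j ⟧ = ⟦ i < j ⟧

  δ-self : ∀ {n} (j : Fin n) → δ j j ≡ 1ℤ
  δ-self zero    = refl
  δ-self (suc j) = δ-self j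

  δ-≢ : ∀ {n} {i j : Fin n} → i ≢ j → δ j i ≡ 0ℤ
  δ-≢ {i = zero}  {zero}  i≢j = contradiction refl i≢j
  δ-≢ {i = suc i} {zero}  _   = refl
  δ-≢ {i = zero}  {suc j} _   = refl
  δ-≢ {i = suc i} {suc j} i≢j = δ-≢ (i≢j ∘ cong suc)

  ⟦<⟧-irrefl : ∀ {n} (j : Fin n) → ⟦ j < j ⟧ ≡ 0ℤ
  ⟦<⟧-irrefl zero    = refl
  ⟦<⟧-irrefl (suc j) = ⟦<⟧-irrefl j

  ⟦fromℕ<⟧ : ∀ {q} (j : Fin (suc q)) → ⟦ fromℕ q < j ⟧ ≡ 0ℤ
  ⟦fromℕ<⟧ zero            = refl
  ⟦fromℕ<⟧ {suc q} (suc j) = ⟦fromℕ<⟧ j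

  ⟦<⟧-yes : ∀ {n} {i j : Fin n} → i Fin.< j → ⟦ i < j ⟧ ≡ 1ℤ
  ⟦<⟧-yes {i = zero}  {suc j} _       = refl
  ⟦<⟧-yes {i = suc i} {suc j} (s≤s p) = ⟦<⟧-yes p

  ⟦<⟧-no : ∀ {n} {i j : Fin n} → j Fin.< i → ⟦ i < j ⟧ ≡ 0ℤ
  ⟦<⟧-no {i = suc i} {zero}  _       = refl
  ⟦<⟧-no {i = suc i} {suc j} (s≤s p) = ⟦<⟧-no p

  prefixSum-zero : ∀ {q} (i : Fin (suc q)) → prefixSum (λ _ → 0ℤ) i ≡ 0ℤ
  prefixSum-zero zero            = refl
  prefixSum-zero {suc q} (suc i) = trans (+-identityˡ _) (prefixSum-zero i)

  prefixSum-δ : ∀ {q} (j i : Fin (suc q)) → prefixSum (δ j) i ≡ 1ℤ - ⟦ i < j ⟧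
  prefixSum-δ zero    zero            = refl
  prefixSum-δ (suc j) zero            = refl
  prefixSum-δ {suc q} zero    (suc i) = cong (λ t → 1ℤ + t) (prefixSum-zero i)
  prefixSum-δ {suc q} (suc j) (suc i) = trans (+-identityˡ _) (prefixSum-δ j i)

  prefixSum-minus-δ : ∀ {q} (b : Fin (suc q) → ℤ) j i →
    prefixSum (λ k → b k - δ j k) i ≡ prefixSum b i - 1ℤ + ⟦ i < j ⟧
  prefixSum-minus-δ b j i = begin
    prefixSum (λ k → b k - δ j k) i    ≡⟨ prefixSum-sub b (δ j) i ⟩
    prefixSum b i - prefixSum (δ j) i  ≡⟨ cong (λ t → prefixSum b i - t) (prefixSum-δ j i) ⟩
    prefixSum b i - (1ℤ - ⟦ i < j ⟧)   ≡⟨ regroup (prefixSum b i) ⟦ i < j ⟧ ⟩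
    prefixSum b i - 1ℤ + ⟦ i < j ⟧     ∎
    where
    regroup : ∀ x y → x - (1ℤ - y) ≡ x - 1ℤ + y
    regroup = solve-∀

  module _ {q : ℕ} where

    Increments : (c d : Fin (suc q) → ℤ) → Set
    Increments c d = ∀ k → c (sucMod k) ≡ c k + d (sucMod k)

    increments⇒prefixSum : ∀ {c d} → Increments c d →
      ∀ i → c i ≡ c (fromℕ q) + prefixSum d i
    increments⇒prefixSum {c} {d} inc = telescope c d {c (fromℕ q)}
      (subst (λ s → c s ≡ c (fromℕ q) + d s) (sucMod-fromℕ q) (inc (fromℕ q)))
      (λ i → subst (λ s → c s ≡ c (inject₁ i) + d s) (sucMod-inject₁ i) (inc (inject₁ i)))

    increments⇒prefixSum-last : ∀ {c d} → Increments c d → prefixSum d (fromℕ q) ≡ 0ℤ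
    increments⇒prefixSum-last {c} {d} inc = begin
      prefixSum d last               ≡⟨ cancel (c last) _ ⟩
      (c last + prefixSum d last) - c last
        ≡⟨ cong (λ t → t - c last) (increments⇒prefixSum {c} {d} inc last) ⟨
      c last - c last                ≡⟨ +-inverseʳ (c last) ⟩
      0ℤ                             ∎
      where
      last = fromℕ q
      cancel : ∀ x y → y ≡ (x + y) - x
      cancel = solve-∀

    prefixSum⇒increments : ∀ {c d K} → prefixSum d (fromℕ q) ≡ 0ℤ →
      (∀ i → c i ≡ K + prefixSum d i) → Increments c d
    prefixSum⇒increments {c} {d} {K} total c≡ k with view k
    ... | ‵fromℕ = begin
      c (sucMod (fromℕ q))                  ≡⟨ cong c (sucMod-fromℕ q) ⟩
      c zero                                ≡⟨ c≡ zero ⟩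
      K + d zero
        ≡⟨ cong (λ t → t + d zero) (trans (cong (λ t → K + t) total) (+-identityʳ K)) ⟨
      (K + prefixSum d (fromℕ q)) + d zero
        ≡⟨ cong₂ _+_ (c≡ (fromℕ q)) (cong d (sucMod-fromℕ q)) ⟨
      c (fromℕ q) + d (sucMod (fromℕ q))    ∎
    ... | ‵inject₁ i = begin
      c (sucMod (inject₁ i))                     ≡⟨ cong c (sucMod-inject₁ i) ⟩
      c (suc i)                                  ≡⟨ c≡ (suc i) ⟩
      K + prefixSum d (suc i)                    ≡⟨ cong (λ t → K + t) (prefixSum-suc d i) ⟩
      K + (prefixSum d (inject₁ i) + d (suc i))  ≡⟨ +-assoc K _ _ ⟨
      (K + prefixSum d (inject₁ i)) + d (suc i)
        ≡⟨ cong₂ _+_ (c≡ (inject₁ i)) (cong d (sucMod-inject₁ i)) ⟨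
      c (inject₁ i) + d (sucMod (inject₁ i))     ∎

    IsLastArgmin : (Fin (suc q) → ℤ) → Fin (suc q) → Set
    IsLastArgmin Q j = (∀ k → k Fin.< j → Q j ≤ Q k) × (∀ k → j Fin.< k → Q j < Q k)

    lastArgmin-unique : ∀ {Q j j′} → IsLastArgmin Q j → IsLastArgmin Q j′ → j ≡ j′
    lastArgmin-unique {j = j} {j′} (before , after) (before′ , after′) with <-cmp j j′
    ... | tri< j<j′ _ _ = contradiction (after j′ j<j′) (≤⇒≯ (before′ j j<j′))
    ... | tri≈ _ j≡j′ _ = j≡j′
    ... | tri> _ _ j′<j = contradiction (after′ j j′<j) (≤⇒≯ (before j′ j′<j))

  lastArgmin : ∀ {q} (Q : Fin (suc q) → ℤ) → Σ (Fin (suc q)) (IsLastArgmin Q)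
  lastArgmin {zero} Q = zero , (λ _ ()) , (λ { zero () })
  lastArgmin {suc q} Q with lastArgmin (Q ∘ suc)
  ... | j , before , after with Q (suc j) ≤? Q zero
  ... | yes Qj≤Q₀ = suc j , before′ , after′
    where
    before′ : ∀ k → k Fin.< suc j → Q (suc j) ≤ Q k
    before′ zero    _       = Qj≤Q₀
    before′ (suc k) (s≤s p) = before k p
    after′ : ∀ k → suc j Fin.< k → Q (suc j) < Q k
    after′ (suc k) (s≤s p) = after k p
  ... | no Qj≰Q₀ = zero , (λ _ ()) , λ { (suc k) _ → after′ k }
    where
    Q₀<Qj : Q zero < Q (suc j)
    Q₀<Qj = ≰⇒> Qj≰Q₀
    after′ : ∀ k → Q zero < Q (suc k)
    after′ k with <-cmp k j
    ... | tri< k<j _ _  = <-≤-trans Q₀<Qj (before k k<j)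
    ... | tri≈ _ refl _ = Q₀<Qj
    ... | tri> _ _ j<k  = <-trans Q₀<Qj (after k j<k)

  module _ {q : ℕ} where

    potential : (Fin (suc q) → ℤ) → Fin (suc q) → Fin (suc q) → ℤ
    potential Q j i = Q i - Q j + ⟦ i < j ⟧

    potential-self : ∀ Q j → potential Q j j ≡ 0ℤ
    potential-self Q j = trans (cong (λ t → Q j - Q j + t) (⟦<⟧-irrefl j))
                               (trans (+-identityʳ _) (+-inverseʳ (Q j)))

    lastArgmin⇒potential-pos : ∀ {Q j} → IsLastArgmin Q j →
      ∀ k → k ≢ j → 0ℤ < potential Q j k
    lastArgmin⇒potential-pos {Q} {j} (before , after) k k≢j with <-cmp k j
    ... | tri< k<j _ _ = subst (λ t → 0ℤ < Q k - Q j + t) (sym (⟦<⟧-yes k<j))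
                               (0≤⇒0<+1 (i≤j⇒0≤j-i (before k k<j)))
    ... | tri≈ _ k≡j _ = contradiction k≡j k≢j
    ... | tri> _ _ j<k = subst (λ t → 0ℤ < Q k - Q j + t) (sym (⟦<⟧-no j<k))
                               (<⇒0<-+0 (after k j<k))

    potential-pos⇒lastArgmin : ∀ {Q j} → (∀ k → k ≢ j → 0ℤ < potential Q j k) →
      IsLastArgmin Q j
    potential-pos⇒lastArgmin {Q} {j} pos = before , after
      where
      before : ∀ k → k Fin.< j → Q j ≤ Q k
      before k k<j = 0≤i-j⇒j≤i (0<+1⇒0≤
        (subst (λ t → 0ℤ < Q k - Q j + t) (⟦<⟧-yes k<j) (pos k (<⇒≢ k<j))))
      after : ∀ k → j Fin.< k → Q j < Q k
      after k j<k = 0<-+0⇒<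
        (subst (λ t → 0ℤ < Q k - Q j + t) (⟦<⟧-no j<k) (pos k (<⇒≢ j<k ∘ sym)))

    lastArgmin⇒potential-nonneg : ∀ {Q j} → IsLastArgmin Q j → ∀ i → 0ℤ ≤ potential Q j i
    lastArgmin⇒potential-nonneg {Q} {j} isMin i with i ≟ j
    ... | yes refl = ≤-reflexive (sym (potential-self Q j))
    ... | no i≢j   = <⇒≤ (lastArgmin⇒potential-pos isMin i i≢j)

    record Balanced (b : Fin (suc q) → ℤ) (j : Fin (suc q)) (c : Fin (suc q) → ℕ) : Set where
      constructor balanced
      field increments : Increments (λ i → + c i) (λ i → b i - δ j i)

    VanishesExactlyAt : (Fin (suc q) → ℕ) → Fin (suc q) → Set
    VanishesExactlyAt c j = c j ≡ 0 × (∀ k → c k ≡ 0 → k ≡ j)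

    Balanced-cong : ∀ {b b′ j c} → (∀ i → b i ≡ b′ i) → Balanced b j c → Balanced b′ j c
    Balanced-cong {j = j} {c} b≗b′ (balanced inc) = balanced λ k →
      trans (inc k) (cong (λ t → + c k + (t - δ j (sucMod k))) (b≗b′ (sucMod k)))

    balanced⇒sum≡1 : ∀ {b j c} → Balanced b j c → prefixSum b (fromℕ q) ≡ 1ℤ
    balanced⇒sum≡1 {b} {j} {c} (balanced inc) = i-j≡0⇒i≡j _ _ (begin
      Q last - 1ℤ                             ≡⟨ +-identityʳ _ ⟨
      Q last - 1ℤ + 0ℤ                        ≡⟨ cong (λ t → Q last - 1ℤ + t) (⟦fromℕ<⟧ j) ⟨
      Q last - 1ℤ + ⟦ last < j ⟧              ≡⟨ prefixSum-minus-δ b j last ⟨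
      prefixSum (λ k → b k - δ j k) last      ≡⟨ increments⇒prefixSum-last {c = λ i → + c i} inc ⟩
      0ℤ                                      ∎)
      where
      Q = prefixSum b
      last = fromℕ q

    balanced⇒potential : ∀ {b j c} → Balanced b j c → c j ≡ 0 →
      ∀ i → + c i ≡ potential (prefixSum b) j i
    balanced⇒potential {b} {j} {c} (balanced inc) cⱼ≡0 i = begin
      + c i                                               ≡⟨ telescoped i ⟩
      K + (Q i - 1ℤ + ⟦ i < j ⟧)                          ≡⟨ +-identityʳ _ ⟨
      K + (Q i - 1ℤ + ⟦ i < j ⟧) - 0ℤ
        ≡⟨ cong (λ t → K + (Q i - 1ℤ + ⟦ i < j ⟧) - t) at-j ⟩
      K + (Q i - 1ℤ + ⟦ i < j ⟧) - (K + (Q j - 1ℤ + 0ℤ))  ≡⟨ cancel K (Q i) (Q j) ⟦ i < j ⟧ ⟩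
      potential Q j i                                     ∎
      where
      Q = prefixSum b
      K = + c (fromℕ q)
      telescoped : ∀ i → + c i ≡ K + (Q i - 1ℤ + ⟦ i < j ⟧)
      telescoped i = trans (increments⇒prefixSum {c = λ i → + c i} inc i)
                           (cong (λ t → K + t) (prefixSum-minus-δ b j i))
      at-j : 0ℤ ≡ K + (Q j - 1ℤ + 0ℤ)
      at-j = trans (cong +_ (sym cⱼ≡0))
                   (trans (telescoped j) (cong (λ t → K + (Q j - 1ℤ + t)) (⟦<⟧-irrefl j)))
      cancel : ∀ K x y l → K + (x - 1ℤ + l) - (K + (y - 1ℤ + 0ℤ)) ≡ x - y + l
      cancel = solve-∀

    balanced⇒lastArgmin : ∀ {b j c} → Balanced b j c → VanishesExactlyAt c j →
      IsLastArgmin (prefixSum b) j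
    balanced⇒lastArgmin bal (cⱼ≡0 , only-j) = potential-pos⇒lastArgmin λ k k≢j →
      subst (0ℤ <_) (balanced⇒potential bal cⱼ≡0 k) (+<+ (n≢0⇒n>0 (k≢j ∘ only-j k)))

    module _ (b : Fin (suc q) → ℤ) where

      private
        cycleZero-isLastArgmin : IsLastArgmin (prefixSum b) (proj₁ (lastArgmin (prefixSum b)))
        cycleZero-isLastArgmin = proj₂ (lastArgmin (prefixSum b))

      cycleZero : Fin (suc q)
      cycleZero = proj₁ (lastArgmin (prefixSum b))

      cycleSolution : Fin (suc q) → ℕ
      cycleSolution i = ∣ potential (prefixSum b) cycleZero i ∣

      +cycleSolution : ∀ i → + cycleSolution i ≡ potential (prefixSum b) cycleZero i
      +cycleSolution i = 0≤i⇒+∣i∣≡i (lastArgmin⇒potential-nonneg cycleZero-isLastArgmin i)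

      cycleSolution-vanishes : VanishesExactlyAt cycleSolution cycleZero
      cycleSolution-vanishes =
        cong ∣_∣ (potential-self (prefixSum b) cycleZero) , only-cycleZero
        where
        only-cycleZero : ∀ k → cycleSolution k ≡ 0 → k ≡ cycleZero
        only-cycleZero k cₖ≡0 = decidable-stable (k ≟ cycleZero) λ k≢j →
          <-irrefl (trans (cong +_ (sym cₖ≡0)) (+cycleSolution k))
                   (lastArgmin⇒potential-pos cycleZero-isLastArgmin k k≢j)

      cycleSolution-balanced : prefixSum b (fromℕ q) ≡ 1ℤ → Balanced b cycleZero cycleSolution
      cycleSolution-balanced total =
        balanced (prefixSum⇒increments {K = 1ℤ - Q j} total′ λ i → begin
          + cycleSolution i                             ≡⟨ +cycleSolution i ⟩
          Q i - Q j + ⟦ i < j ⟧                         ≡⟨ regroup (Q i) (Q j) ⟦ i < j ⟧ ⟩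
          (1ℤ - Q j) + (Q i - 1ℤ + ⟦ i < j ⟧)
            ≡⟨ cong (λ t → (1ℤ - Q j) + t) (prefixSum-minus-δ b j i) ⟨
          (1ℤ - Q j) + prefixSum (λ k → b k - δ j k) i  ∎)
        where
        Q = prefixSum b
        j = cycleZero
        total′ : prefixSum (λ k → b k - δ j k) (fromℕ q) ≡ 0ℤ
        total′ = trans (prefixSum-minus-δ b j (fromℕ q))
                       (cong₂ (λ s t → s - 1ℤ + t) total (⟦fromℕ<⟧ j))
        regroup : ∀ x y l → x - y + l ≡ (1ℤ - y) + (x - 1ℤ + l)
        regroup = solve-∀

      cycleSolution-unique : ∀ {j c} → Balanced b j c → VanishesExactlyAt c j →
        ∀ i → c i ≡ cycleSolution i
      cycleSolution-unique {j} {c} bal vanishes i = +-injective (begin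
        + c i                                ≡⟨ balanced⇒potential bal (proj₁ vanishes) i ⟩
        potential (prefixSum b) j i          ≡⟨ cong (λ j → potential (prefixSum b) j i) j≡cycleZero ⟩
        potential (prefixSum b) cycleZero i  ≡⟨ +cycleSolution i ⟨
        + cycleSolution i                    ∎)
        where
        j≡cycleZero : j ≡ cycleZero
        j≡cycleZero = lastArgmin-unique (balanced⇒lastArgmin bal vanishes) cycleZero-isLastArgmin

module FlowConservation where

  open import Level using (0ℓ)
  open import Data.Nat as ℕ using ()
  open import Data.Nat.Properties as ℕ using ()
  open import Data.Nat.ListAction using () renaming (sum to sumList)
  open import Data.Integer using (ℤ; +_; 0ℤ; 1ℤ; _+_; _-_)
  open import Data.Integer.Properties using (+-identityʳ; +-injective; pos-+)
  open import Data.Integer.Tactic.RingSolver using (solve-∀)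
  open import Data.Fin using (zero; suc; fromℕ; _≟_)
  open import Data.Fin.Properties using (suc-injective; 0≢1+n)
  open import Data.List using (List; []; _∷_; _++_; map; filter; tabulate)
  open import Data.List.Properties
    using (filter-++; filter-none; filter-accept; filter-reject; map-tabulate)
  open import Data.List.Relation.Unary.All.Properties using (tabulate⁺)
  open import Data.Vec using ([]; _∷_; lookup)
  open import Data.Product using (_×_; _,_; proj₁)
  open import Function using (_∘_; id)
  open import Function.Bundles using (_⇔_; mk⇔; Equivalence)
  open import Relation.Binary.PropositionalEquality
    using (_≡_; _≢_; refl; sym; trans; cong; cong₂; subst; module ≡-Reasoning)
  open import Relation.Nullary using (¬_; yes; no)
  open import Relation.Unary using (Pred; Decidable)
  open CyclicSuccessor
  open CycleLemma
  open ≡-Reasoning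

  module _ {A : Set} {P : Pred A 0ℓ} (P? : Decidable P) where

    filter-tabulate-none : ∀ {n} (g : Fin n → A) → (∀ k → ¬ P (g k)) →
      filter P? (tabulate g) ≡ []
    filter-tabulate-none g none = filter-none P? (tabulate⁺ none)

    filter-tabulate-unique : ∀ {n} (g : Fin n → A) {i} → P (g i) → (∀ k → P (g k) → k ≡ i) →
      filter P? (tabulate g) ≡ g i ∷ []
    filter-tabulate-unique g {zero} pᵢ only-i = trans (filter-accept P? pᵢ)
      (cong (g zero ∷_) (filter-tabulate-none (g ∘ suc) λ k p → 0≢1+n (sym (only-i (suc k) p))))
    filter-tabulate-unique g {suc i} pᵢ only-i =
      trans (filter-reject P? λ p₀ → 0≢1+n (only-i zero p₀))
            (filter-tabulate-unique (g ∘ suc) pᵢ λ k p → suc-injective (only-i (suc k) p))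

  module _ {q : ℕ} where

    private
      p = suc q

    filter-allEdges : ∀ {P : Pred (Edge p) 0ℓ} (P? : Decidable P) →
      filter P? (allEdges p)
        ≡ filter P? (tabulate inE) ++ filter P? (tabulate outE) ++ filter P? (tabulate cycE)
    filter-allEdges P? = begin
      filter P? (allEdges p)
        ≡⟨ cong (filter P?) (cong₂ _++_ (map-tabulate id inE)
                             (cong₂ _++_ (map-tabulate id outE) (map-tabulate id cycE))) ⟩
      filter P? (tabulate inE ++ tabulate outE ++ tabulate cycE)
        ≡⟨ filter-++ P? (tabulate inE) _ ⟩
      filter P? (tabulate inE) ++ filter P? (tabulate outE ++ tabulate cycE)
        ≡⟨ cong (filter P? (tabulate inE) ++_) (filter-++ P? (tabulate outE) _) ⟩
      filter P? (tabulate inE) ++ filter P? (tabulate outE) ++ filter P? (tabulate cycE)  ∎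

    leaves : (v : Vertex p) → Decidable (λ e → tail e ≡ v)
    leaves v e = tail e ≟V v

    enters : (v : Vertex p) → Decidable (λ e → head e ≡ v)
    enters v e = head e ≟V v

    edgesOut edgesIn : Vertex p → List (Edge p)
    edgesOut v = filter (leaves v) (allEdges p)
    edgesIn  v = filter (enters v) (allEdges p)

    edgesOut-src : ∀ i → edgesOut (src i) ≡ inE i ∷ []
    edgesOut-src i = trans (filter-allEdges P?) (cong₂ _++_
      (filter-tabulate-unique P? inE refl λ { k refl → refl })
      (cong₂ _++_ (filter-tabulate-none P? outE λ _ ()) (filter-tabulate-none P? cycE λ _ ())))
      where P? = leaves (src i)

    edgesIn-src : ∀ i → edgesIn (src i) ≡ []
    edgesIn-src i = trans (filter-allEdges P?) (cong₂ _++_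
      (filter-tabulate-none P? inE λ _ ())
      (cong₂ _++_ (filter-tabulate-none P? outE λ _ ()) (filter-tabulate-none P? cycE λ _ ())))
      where P? = enters (src i)

    edgesOut-mid : ∀ i → edgesOut (mid i) ≡ outE i ∷ cycE i ∷ []
    edgesOut-mid i = trans (filter-allEdges P?) (cong₂ _++_
      (filter-tabulate-none P? inE λ _ ())
      (cong₂ _++_ (filter-tabulate-unique P? outE refl λ { k refl → refl })
                  (filter-tabulate-unique P? cycE refl λ { k refl → refl })))
      where P? = leaves (mid i)

    edgesIn-mid : ∀ k → edgesIn (mid (sucMod k)) ≡ inE (sucMod k) ∷ cycE k ∷ []
    edgesIn-mid k = trans (filter-allEdges P?) (cong₂ _++_
      (filter-tabulate-unique P? inE refl λ { m refl → refl })
      (cong₂ _++_ (filter-tabulate-none P? outE λ _ ())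
                  (filter-tabulate-unique P? cycE refl λ { m eq → sucMod-injective (mid-injective eq) })))
      where
      P? = enters (mid (sucMod k))
      mid-injective : ∀ {i j : Fin p} → mid i ≡ mid j → i ≡ j
      mid-injective refl = refl

    netflow-src : ∀ (f : Edge p → ℕ) i → netflow f (src i) ≡ + f (inE i)
    netflow-src f i = begin
      netflow f (src i)
        ≡⟨ cong₂ (λ out in′ → + sumList (map f out) - + sumList (map f in′))
                 (edgesOut-src i) (edgesIn-src i) ⟩
      + (f (inE i) ℕ.+ 0) - 0ℤ  ≡⟨ +-identityʳ _ ⟩
      + (f (inE i) ℕ.+ 0)       ≡⟨ cong +_ (ℕ.+-identityʳ _) ⟩
      + f (inE i)               ∎

    netflow-mid : ∀ (f : Edge p → ℕ) k → let s = sucMod k in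
      netflow f (mid s) ≡ (+ f (outE s) + + f (cycE s)) - (+ f (inE s) + + f (cycE k))
    netflow-mid f k = trans
      (cong₂ (λ out in′ → + sumList (map f out) - + sumList (map f in′))
             (edgesOut-mid s) (edgesIn-mid k))
      (cong₂ _-_ (pair (f (outE s)) (f (cycE s))) (pair (f (inE s)) (f (cycE k))))
      where
      s = sucMod k
      pair : ∀ x y → + (x ℕ.+ (y ℕ.+ 0)) ≡ + x + + y
      pair x y = trans (cong (λ n → + (x ℕ.+ n)) (ℕ.+-identityʳ y)) (pos-+ x y)

  excess : ∀ {n} → (Fin n → ℕ) → (Fin n → ℕ) → Fin n → ℤ
  excess x y i = 1ℤ + + x i - + y i

  prefixSum-excess : ∀ {n} (x y : Vec ℕ (suc n)) →
    prefixSum (excess (lookup x) (lookup y)) (fromℕ n) ≡ 1ℤ + + n + + sum x - + sum y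
  prefixSum-excess (x ∷ []) (y ∷ []) =
    cong₂ (λ s t → 1ℤ + + s - + t) (sym (ℕ.+-identityʳ x)) (sym (ℕ.+-identityʳ y))
  prefixSum-excess {suc n} (x ∷ xs) (y ∷ ys) = begin
    (1ℤ + + x - + y) + prefixSum (excess (lookup xs) (lookup ys)) (fromℕ n)
      ≡⟨ cong (λ t → (1ℤ + + x - + y) + t) (prefixSum-excess xs ys) ⟩
    (1ℤ + + x - + y) + (1ℤ + + n + + sum xs - + sum ys)
      ≡⟨ regroup (+ x) (+ y) (+ n) (+ sum xs) (+ sum ys) ⟩
    1ℤ + (1ℤ + + n) + (+ x + + sum xs) - (+ y + + sum ys)
      ≡⟨ cong₂ (λ s t → 1ℤ + s - t)
               (cong₂ _+_ (sym (pos-+ 1 n)) (sym (pos-+ x (sum xs)))) (sym (pos-+ y (sum ys))) ⟩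
    1ℤ + + suc n + + (x ℕ.+ sum xs) - + (y ℕ.+ sum ys)  ∎
    where
    regroup : ∀ x y n sx sy →
      (1ℤ + x - y) + (1ℤ + n + sx - sy) ≡ 1ℤ + (1ℤ + n) + (x + sx) - (y + sy)
    regroup = solve-∀

  prefixSum-excess≡1⇔ : ∀ {n} (x y : Vec ℕ (suc n)) →
    (prefixSum (excess (lookup x) (lookup y)) (fromℕ n) ≡ 1ℤ) ⇔ (sum y ≡ sum x ℕ.+ n)
  prefixSum-excess≡1⇔ {n} x y = mk⇔
    (λ total → +-injective (begin
      + sum y                                  ≡⟨ isolate (+ n) (+ sum x) (+ sum y) ⟩
      (1ℤ + + n + + sum x) - (1ℤ + + n + + sum x - + sum y)
        ≡⟨ cong (λ t → (1ℤ + + n + + sum x) - t) (trans (sym (prefixSum-excess x y)) total) ⟩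
      (1ℤ + + n + + sum x) - 1ℤ                ≡⟨ drop-one (+ n) (+ sum x) ⟩
      + sum x + + n                            ≡⟨ pos-+ (sum x) n ⟨
      + (sum x ℕ.+ n)                          ∎))
    (λ sum-y → begin
      prefixSum (excess (lookup x) (lookup y)) (fromℕ n)  ≡⟨ prefixSum-excess x y ⟩
      1ℤ + + n + + sum x - + sum y
        ≡⟨ cong (λ t → 1ℤ + + n + + sum x - t) (trans (cong +_ sum-y) (pos-+ (sum x) n)) ⟩
      1ℤ + + n + + sum x - (+ sum x + + n)                ≡⟨ leave-one (+ n) (+ sum x) ⟩
      1ℤ                                                  ∎)
    where
    isolate : ∀ n s t → t ≡ (1ℤ + n + s) - (1ℤ + n + s - t)
    isolate = solve-∀
    drop-one : ∀ n s → (1ℤ + n + s) - 1ℤ ≡ s + n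
    drop-one = solve-∀
    leave-one : ∀ n s → 1ℤ + n + s - (s + n) ≡ 1ℤ
    leave-one = solve-∀

  conservation⇔increment : ∀ y cₛ x cₖ d →
    ((y + cₛ) - (x + cₖ) ≡ 1ℤ - d) ⇔ (cₛ ≡ cₖ + ((1ℤ + x - y) - d))
  conservation⇔increment y cₛ x cₖ d = mk⇔
    (λ conserved → begin
      cₛ                                    ≡⟨ isolate y cₛ x cₖ ⟩
      cₖ + (((y + cₛ) - (x + cₖ)) + x - y)  ≡⟨ cong (λ t → cₖ + (t + x - y)) conserved ⟩
      cₖ + ((1ℤ - d) + x - y)               ≡⟨ reorder x y d cₖ ⟩
      cₖ + ((1ℤ + x - y) - d)               ∎)
    (λ increment → begin
      (y + cₛ) - (x + cₖ)                         ≡⟨ cong (λ t → (y + t) - (x + cₖ)) increment ⟩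
      (y + (cₖ + ((1ℤ + x - y) - d))) - (x + cₖ)  ≡⟨ collapse y x cₖ d ⟩
      1ℤ - d                                      ∎)
    where
    isolate : ∀ y cₛ x cₖ → cₛ ≡ cₖ + (((y + cₛ) - (x + cₖ)) + x - y)
    isolate = solve-∀
    reorder : ∀ x y d cₖ → cₖ + ((1ℤ - d) + x - y) ≡ cₖ + ((1ℤ + x - y) - d)
    reorder = solve-∀
    collapse : ∀ y x cₖ d → (y + (cₖ + ((1ℤ + x - y) - d))) - (x + cₖ) ≡ 1ℤ - d
    collapse = solve-∀

  ≡1-δ⇔ : ∀ {n} (g : Fin n → ℤ) j →
    (g j ≡ 0ℤ × (∀ i → i ≢ j → g i ≡ 1ℤ)) ⇔ (∀ i → g i ≡ 1ℤ - δ j i)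
  ≡1-δ⇔ g j = mk⇔
    (λ (gⱼ≡0 , others≡1) i → by-cases i gⱼ≡0 others≡1)
    (λ g≡ → trans (g≡ j) (cong (1ℤ -_) (δ-self j)) ,
            λ i i≢j → trans (g≡ i) (cong (1ℤ -_) (δ-≢ i≢j)))
    where
    by-cases : ∀ i → g j ≡ 0ℤ → (∀ i → i ≢ j → g i ≡ 1ℤ) → g i ≡ 1ℤ - δ j i
    by-cases i gⱼ≡0 others≡1 with i ≟ j
    ... | yes refl = trans gⱼ≡0 (sym (cong (1ℤ -_) (δ-self j)))
    ... | no i≢j   = trans (others≡1 i i≢j) (sym (cong (1ℤ -_) (δ-≢ i≢j)))

  module _ {q : ℕ} (f : Edge (suc q) → ℕ) where

    private
      b = excess (f ∘ inE) (f ∘ outE)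

    mid-conservation⇔balanced : ∀ j →
      (∀ i → netflow f (mid i) ≡ 1ℤ - δ j i) ⇔ Balanced b j (f ∘ cycE)
    mid-conservation⇔balanced j = mk⇔
      (λ conserved → balanced λ k →
        Equivalence.to (at k) (trans (sym (netflow-mid f k)) (conserved (sucMod k))))
      (λ (balanced inc) i → subst (λ i → netflow f (mid i) ≡ 1ℤ - δ j i) (sucMod-predMod i)
        (trans (netflow-mid f (predMod i)) (Equivalence.from (at (predMod i)) (inc (predMod i)))))
      where
      at : ∀ k → let s = sucMod k in
        ((+ f (outE s) + + f (cycE s)) - (+ f (inE s) + + f (cycE k)) ≡ 1ℤ - δ j s)
          ⇔ (+ f (cycE s) ≡ + f (cycE k) + (b s - δ j s))
      at k = conservation⇔increment (+ f (outE s)) (+ f (cycE s)) (+ f (inE s)) (+ f (cycE k)) (δ j s)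
        where s = sucMod k

    cyclicFlow⇒vanishes : (cyclic : IsCyclicFlow f) → VanishesExactlyAt (f ∘ cycE) (proj₁ cyclic)
    cyclicFlow⇒vanishes (_ , zero-at-j , only-j , _) = zero-at-j , only-j

    cyclicFlow⇒balanced : (cyclic : IsCyclicFlow f) → Balanced b (proj₁ cyclic) (f ∘ cycE)
    cyclicFlow⇒balanced (j , _ , _ , net-j , net-others) =
      Equivalence.to (mid-conservation⇔balanced j) (Equivalence.to (≡1-δ⇔ _ j) (net-j , net-others))

    balanced⇒cyclicFlow : ∀ {j} → Balanced b j (f ∘ cycE) → VanishesExactlyAt (f ∘ cycE) j →
      IsCyclicFlow f
    balanced⇒cyclicFlow {j} bal (zero-at-j , only-j) = j , zero-at-j , only-j ,
      Equivalence.from (≡1-δ⇔ _ j) (Equivalence.from (mid-conservation⇔balanced j) bal)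

module CyclicFlowsAsCompositions (q : ℕ) (a : Vec ℕ (suc q)) where

  open import Data.Nat as ℕ using ()
  open import Data.Integer using (+_; 1ℤ; _+_; _-_)
  open import Data.Integer.Properties using (+-injective)
  open import Data.Vec using (lookup; tabulate)
  open import Data.Vec.Properties using (lookup∘tabulate; tabulate∘lookup; tabulate-cong)
  open import Data.Product using (_,_; proj₁)
  open import Function using (_∘_)
  open import Function.Bundles using (Equivalence; Inverse)
  open import Relation.Binary.PropositionalEquality using (_≡_; refl; sym; trans; cong₂; setoid)
  open Compositions
  open CycleLemma
  open FlowConservation

  SinkFlows : Set
  SinkFlows = Composition (sum a ℕ.+ q) (suc q)

  flowOf : Vec ℕ (suc q) → Edge (suc q) → ℕ
  flowOf y (inE i)  = lookup a i
  flowOf y (outE i) = lookup y i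
  flowOf y (cycE i) = cycleSolution (excess (lookup a) (lookup y)) i

  toFlow : SinkFlows → CyclicFlow (suc q) a
  toFlow (y , sum-y) = record
    { flow    = flowOf y
    ; cyclic  = balanced⇒cyclicFlow (flowOf y)
                  (cycleSolution-balanced b (Equivalence.from (prefixSum-excess≡1⇔ a y) sum-y))
                  (cycleSolution-vanishes b)
    ; srcFlow = netflow-src (flowOf y)
    }
    where b = excess (lookup a) (lookup y)

  module _ (F : CyclicFlow (suc q) a) where

    sinkFlows : Vec ℕ (suc q)
    sinkFlows = tabulate (flow F ∘ outE)

    flow-inE : ∀ i → flow F (inE i) ≡ lookup a i
    flow-inE i = +-injective (trans (sym (netflow-src (flow F) i)) (srcFlow F i))

    sinkFlows-balanced :
      Balanced (excess (lookup a) (lookup sinkFlows)) (proj₁ (cyclic F)) (flow F ∘ cycE)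
    sinkFlows-balanced = Balanced-cong
      (λ i → cong₂ (λ s t → 1ℤ + + s - + t) (flow-inE i) (sym (lookup∘tabulate (flow F ∘ outE) i)))
      (cyclicFlow⇒balanced (flow F) (cyclic F))

  fromFlow : CyclicFlow (suc q) a → SinkFlows
  fromFlow F = sinkFlows F ,
    Equivalence.to (prefixSum-excess≡1⇔ a (sinkFlows F)) (balanced⇒sum≡1 (sinkFlows-balanced F))

  fromFlow-cong : ∀ {F G} → F ≈F G → fromFlow F ≡ fromFlow G
  fromFlow-cong F≈G = Composition-≡ (tabulate-cong (λ i → F≈G (outE i)))

  fromFlow-toFlow : ∀ c → fromFlow (toFlow c) ≡ c
  fromFlow-toFlow (y , _) = Composition-≡ (tabulate∘lookup y)

  toFlow-fromFlow : ∀ F → toFlow (fromFlow F) ≈F F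
  toFlow-fromFlow F (inE i)  = sym (flow-inE F i)
  toFlow-fromFlow F (outE i) = lookup∘tabulate (flow F ∘ outE) i
  toFlow-fromFlow F (cycE i) =
    sym (cycleSolution-unique _ (sinkFlows-balanced F) (cyclicFlow⇒vanishes (flow F) (cyclic F)) i)

  sinkFlows↔cyclicFlows : Inverse (setoid SinkFlows) (CyclicFlowSetoid (suc q) a)
  sinkFlows↔cyclicFlows = record
    { to        = toFlow
    ; from      = fromFlow
    ; to-cong   = λ { refl _ → refl }
    ; from-cong = λ {F} {G} → fromFlow-cong {F} {G}
    ; inverse   = (λ { {F} refl → toFlow-fromFlow F })
                , λ {c} {F} F≈ → trans (fromFlow-cong {F} {toFlow c} F≈) (fromFlow-toFlow c)
    }

open import Data.Nat using (_+_; _*_; _∸_; _≤_)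
open import Data.Nat.Combinatorics using (_C_)
open import Data.Nat.Tactic.RingSolver using (solve-∀)
open import Function.Bundles using (Bijection; _↔_)
open import Function.Construct.Composition using (inverse)
open import Function.Properties.Inverse using (Inverse⇒Bijection)
open import Relation.Binary.PropositionalEquality using (_≡_; sym; cong; subst; setoid)
open Compositions using (Composition; stars-and-bars)
open CyclicFlowsAsCompositions using (sinkFlows↔cyclicFlows)

m+2[1+n]∸2≡m+n+n : ∀ m n → m + 2 * suc n ∸ 2 ≡ m + n + n
m+2[1+n]∸2≡m+n+n m n = cong (_∸ 2) (expand m n)
  where
  expand : ∀ m n → m + 2 * suc n ≡ 2 + (m + n + n)
  expand = solve-∀

lemma8p4 : (p : ℕ) → 1 ≤ p → (a : Vec ℕ p) →
    Bijection (setoid (Fin ((sum a + 2 * p ∸ 2) C (p ∸ 1)))) (CyclicFlowSetoid p a)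
lemma8p4 zero    ()
lemma8p4 (suc q) _ a = Inverse⇒Bijection (inverse count (sinkFlows↔cyclicFlows q a))
  where
  count : Fin ((sum a + 2 * suc q ∸ 2) C q) ↔ Composition (sum a + q) (suc q)
  count = subst (λ n → Fin (n C q) ↔ Composition (sum a + q) (suc q))
                (sym (m+2[1+n]∸2≡m+n+n (sum a) q)) (stars-and-bars q (sum a + q))
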